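{- Let $G=(V,E)$ be a 2-sparse graph and suppose a list $L_{uv}$ of colours is associated to each edge $uv\in E$. Let $S$ be a stable set of $G$ containing every vertex of degree at least 3. Suppose that for every vertex $u\in S$, all edges incident to $u$ have the same list. If $|L_{uv}|\geq \max\{\deg_G(u),\deg_G(v)\}$ for every edge $uv\in E$, and $|L_{uv}|\geq 3$ for every edge $uv\in E$ with no end in $S$, then there is an edge-colouring $\pi$ of $G$ with $\pi(uv)\in L_{uv}$ for every $uv\in E$.
   Context: Graphs are finite and simple. A graph is 2-sparse if every edge is incident to at least one vertex of degree at most 2. An edge-colouring assigns colours to edges so that edges sharing an endpoint receive distinct colours. A stable set is a set of pairwise non-adjacent vertices. -}

module Defs where

open import Data.Nat using (ℕ; _≤_; _⊔_)
open import Data.Bool using (Bool; true; false; T)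
open import Data.Fin using (Fin)
open import Data.List using (List; length; filterᵇ; allFin)
open import Data.List.Membership.Propositional using (_∈_)
open import Data.List.Relation.Unary.Unique.Propositional using (Unique)
open import Relation.Nullary using (¬_)
open import Relation.Binary.PropositionalEquality using (_≡_)
open import Data.Product using (_×_; ∃)
open import Data.Sum using (_⊎_)

record Graph (n : ℕ) : Set where
  field
    adj    : Fin n → Fin n → Bool
    adj-sym    : ∀ u v → adj u v ≡ adj v u
    adj-irrefl : ∀ u → adj u u ≡ false

open Graph public

Edge : ∀ {n} → Graph n → Fin n → Fin n → Set
Edge G u v = T (adj G u v)

deg : ∀ {n} → Graph n → Fin n → ℕ
deg {n} G u = length (filterᵇ (adj G u) (allFin n))

TwoSparse : ∀ {n} → Graph n → Set
TwoSparse G = ∀ u v → Edge G u v → deg G u ≤ 2 ⊎ deg G v ≤ 2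

Stable : ∀ {n} → Graph n → (Fin n → Set) → Set
Stable G S = ∀ u v → S u → S v → ¬ Edge G u v

record ListAssignment {n} (G : Graph n) : Set where
  field
    L        : Fin n → Fin n → List ℕ
    L-sym    : ∀ u v → Edge G u v → L u v ≡ L v u
    L-unique : ∀ u v → Edge G u v → Unique (L u v)

open ListAssignment public

-- |L_uv| (the list is duplicate-free, so this is its cardinality)
∣L∣ : ∀ {n} {G : Graph n} → ListAssignment G → Fin n → Fin n → ℕ
∣L∣ 𝓛 u v = length (L 𝓛 u v)

IsListEdgeColouring : ∀ {n} (G : Graph n) → ListAssignment G → (Fin n → Fin n → ℕ) → Set
IsListEdgeColouring G 𝓛 π =
    (∀ u v → Edge G u v → π u v ≡ π v u)
  × (∀ u v w → Edge G u v → Edge G u w → ¬ v ≡ w → ¬ π u v ≡ π u w)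
  × (∀ u v → Edge G u v → π u v ∈ L 𝓛 u v)

-- Induction on the degree sum. Vertices outside S have degree at most 2 and S is stable, so an edge
-- with no end in S, or with an end of degree 1, can be removed and coloured last: its list is longer
-- than the number of edges next to it. Otherwise some v ∉ S of degree 2 lies between u, u′ ∈ S, and
-- all lists at u (resp. u′) coincide. If both lists at v have at least 3 colours, distinct colours c
-- and c′ are reserved by deleting c from all lists at u and c′ from all lists at u′; after colouring
-- G − v the edges uv and u′v get c and c′. Otherwise, say, the lists at u have 2 colours; then u has
-- a second neighbour w ∉ S whose other neighbour u″ may be assumed to lie in S. If u″ = u′, colouring
-- G − u gives different colours to u′v and u′w; if not, the path v – u – w – u″ is replaced by an edge
-- vu″ carrying the list of wu″, which forces different colours at v towards u′ and u″. Either way the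
-- two edges at u can then be coloured from its two colours.

module Submission where

open import Defs
open import Data.Nat using (ℕ; _≤_; _⊔_)
open import Data.Fin using (Fin)
open import Data.Product using (_×_; ∃)
open import Relation.Nullary using (¬_)
open import Relation.Binary.PropositionalEquality using (_≡_)

open import Data.Bool using (T; _∧_; _∨_; not)
open import Data.Bool.Properties using (T-∧; T-∨)
open import Data.Empty using (⊥; ⊥-elim)
import Data.Fin as Fin
open import Data.Fin.Properties using (_≟_; any?; all?)
open import Data.Fin.Subset using (Subset; inside; outside) renaming (_∈_ to _∈ˢ_)
open import Data.Fin.Subset.Properties using (anySubset?) renaming (_∈?_ to _∈ˢ?_)
open import Data.List using (List; []; _∷_; [_]; length; map; _++_; filter; filterᵇ; allFin)
open import Data.List.Membership.Propositional using (_∈_; _∉_; find; lose)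
open import Data.List.Membership.Propositional.Properties
  using (∈-∃++; ∈-++⁻; ∈-++⁺ˡ; ∈-++⁺ʳ; ∈-map⁺; ∈-filter⁺; ∈-filter⁻; ∈-allFin)
open import Data.List.Properties using (length-++; length-map; ≡-dec)
open import Data.List.Relation.Binary.Subset.Propositional using (_⊆_)
open import Data.List.Relation.Unary.All as All using ([]; _∷_)
open import Data.List.Relation.Unary.AllPairs using ([]; _∷_)
open import Data.List.Relation.Unary.Any using (here; there) renaming (any? to Any-any?)
open import Data.List.Relation.Unary.Unique.Propositional using (Unique)
open import Data.List.Relation.Unary.Unique.Propositional.Properties using (filter⁺; allFin⁺)
open import Data.Nat using (zero; suc; _+_; _<_; z≤n; s≤s; _≤?_)
open import Data.Nat.Induction using (<-wellFounded)
open import Data.Nat.ListAction using (sum)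
open import Data.Nat.Properties
  using (module ≤-Reasoning; ≤-trans; <-≤-trans; ≤-pred; ≤-reflexive; ≰⇒>; <⇒≱; +-mono-≤; +-mono-<-≤; +-mono-≤-<;
         +-suc; +-comm; m≤m⊔n)
open import Data.Product using (_,_; proj₁; proj₂; ∃₂)
open import Data.Sum using (_⊎_; inj₁; inj₂; [_,_]′)
open import Data.Vec.Base using ([]; _∷_; here; there)
open import Function using (id; _∘_; _⇔_; mk⇔; Equivalence)
open import Induction.WellFounded as WF using (WellFounded)
open import Level using (0ℓ)
open import Relation.Binary.Definitions using (DecidableEquality)
import Relation.Binary.Construct.On as On
open import Relation.Binary.PropositionalEquality using (refl; sym; trans; cong; cong₂; subst; _≢_; module ≡-Reasoning)
open import Relation.Nullary using (Dec; yes; no; contradiction)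
open import Relation.Nullary.Decidable
  using (¬?; T?; _×-dec_; _⊎-dec_; _→-dec_; isYes; decidable-stable; toWitness; fromWitness;
         toWitnessFalse; fromWitnessFalse)
open import Relation.Nullary.Decidable.Core using (¬¬-excluded-middle)
open import Relation.Nullary.Negation using (¬¬-map)

private
  variable
    n : ℕ

unique∧⊆⇒length≤ : ∀ {A : Set} {xs ys : List A} → Unique xs → xs ⊆ ys → length xs ≤ length ys
unique∧⊆⇒length≤ {xs = []} _ _ = z≤n
unique∧⊆⇒length≤ {xs = x ∷ xs} (x∉xs ∷ xs!) xs⊆ys with ∈-∃++ (xs⊆ys (here refl))
... | as , bs , refl = ≤-trans (s≤s (unique∧⊆⇒length≤ xs! xs⊆as++bs)) (≤-reflexive length-insert)
  where
  xs⊆as++bs : xs ⊆ as ++ bs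
  xs⊆as++bs {z} z∈xs with ∈-++⁻ as (xs⊆ys (there z∈xs))
  ... | inj₁ z∈as = ∈-++⁺ˡ z∈as
  ... | inj₂ (here refl) = contradiction refl (All.lookup x∉xs z∈xs)
  ... | inj₂ (there z∈bs) = ∈-++⁺ʳ as z∈bs
  length-insert : suc (length (as ++ bs)) ≡ length (as ++ x ∷ bs)
  length-insert rewrite length-++ as {bs} | length-++ as {x ∷ bs} = sym (+-suc (length as) (length bs))

module WithDecidableEquality {A : Set} (_≟ᴬ_ : DecidableEquality A) where

  open import Data.List.Membership.DecPropositional _≟ᴬ_ using (_∈?_)

  longer⇒∃∉ : ∀ {xs ys : List A} → Unique xs → length ys < length xs → ∃ λ x → x ∈ xs × x ∉ ys
  longer⇒∃∉ {xs} {ys} xs! ys<xs with Any-any? (λ x → ¬? (x ∈? ys)) xs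
  ... | yes some∉ = find some∉
  ... | no none∉ = contradiction (unique∧⊆⇒length≤ xs! xs⊆ys) (<⇒≱ ys<xs)
    where
    xs⊆ys : xs ⊆ ys
    xs⊆ys x∈xs = decidable-stable (_ ∈? ys) (none∉ ∘ lose x∈xs)

  without : A → List A → List A
  without c = filter (λ x → ¬? (x ≟ᴬ c))

  ∈-without⁻ : ∀ {c x xs} → x ∈ without c xs → x ∈ xs × x ≢ c
  ∈-without⁻ {c} = ∈-filter⁻ (λ x → ¬? (x ≟ᴬ c))

  without-unique : ∀ {c xs} → Unique xs → Unique (without c xs)
  without-unique {c} = filter⁺ (λ x → ¬? (x ≟ᴬ c))

  length-without : ∀ {c xs} → Unique xs → length xs ≤ suc (length (without c xs))
  length-without {c} {xs} xs! = unique∧⊆⇒length≤ xs! xs⊆c∷without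
    where
    xs⊆c∷without : xs ⊆ c ∷ without c xs
    xs⊆c∷without {x} x∈xs with x ≟ᴬ c
    ... | yes x≡c = here x≡c
    ... | no x≢c = there (∈-filter⁺ (λ y → ¬? (y ≟ᴬ c)) x∈xs x≢c)

  pair-avoiding : ∀ {xs α β} → Unique xs → 2 ≤ length xs → α ≢ β
                → ∃₂ λ x y → x ∈ xs × y ∈ xs × x ≢ y × x ≢ α × y ≢ β
  pair-avoiding {[]} _ () _
  pair-avoiding {_ ∷ []} _ (s≤s ()) _
  pair-avoiding {p ∷ q ∷ _} {α} {β} ((p≢q ∷ _) ∷ _) _ α≢β with p ≟ᴬ α | q ≟ᴬ β
  ... | no p≢α | no q≢β = p , q , here refl , there (here refl) , p≢q , p≢α , q≢β
  ... | yes refl | _ = q , p , there (here refl) , here refl , p≢q ∘ sym , p≢q ∘ sym , α≢β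
  ... | no p≢α | yes refl = q , p , there (here refl) , here refl , p≢q ∘ sym , α≢β ∘ sym , p≢q

open WithDecidableEquality Data.Nat._≟_

module _ (G : Graph n) where

  Edge-sym : ∀ {u v} → Edge G u v → Edge G v u
  Edge-sym {u} {v} = subst T (adj-sym G u v)

  Edge⇒≢ : ∀ {u v} → Edge G u v → u ≢ v
  Edge⇒≢ {u} e refl = subst T (adj-irrefl G u) e

  neighbours : Fin n → List (Fin n)
  neighbours u = filterᵇ (adj G u) (allFin n)

  neighbours-unique : ∀ u → Unique (neighbours u)
  neighbours-unique u = filter⁺ (T? ∘ adj G u) (allFin⁺ n)

  ∈-neighbours⁺ : ∀ {u v} → Edge G u v → v ∈ neighbours u
  ∈-neighbours⁺ {u} {v} = ∈-filter⁺ (T? ∘ adj G u) (∈-allFin v)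

  ∈-neighbours⁻ : ∀ {u v} → v ∈ neighbours u → Edge G u v
  ∈-neighbours⁻ {u} = proj₂ ∘ ∈-filter⁻ (T? ∘ adj G u) {xs = allFin n}

  deg≤length : ∀ u {ys} → (∀ {v} → Edge G u v → v ∈ ys) → deg G u ≤ length ys
  deg≤length u ⊇nbrs = unique∧⊆⇒length≤ (neighbours-unique u) (⊇nbrs ∘ ∈-neighbours⁻)

  length≤deg : ∀ u {ys} → Unique ys → (∀ {v} → v ∈ ys → Edge G u v) → length ys ≤ deg G u
  length≤deg u ys! ⊆nbrs = unique∧⊆⇒length≤ ys! (∈-neighbours⁺ ∘ ⊆nbrs)

  2≤deg : ∀ {u v w} → Edge G u v → Edge G u w → v ≢ w → 2 ≤ deg G u
  2≤deg {u} uv uw v≢w = length≤deg u ((v≢w ∷ []) ∷ [] ∷ []) λ { (here refl) → uv ; (there (here refl)) → uw }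

  deg≤2⇒neighbour : ∀ {u v w z} → deg G u ≤ 2 → Edge G u v → Edge G u w → v ≢ w → Edge G u z → z ≡ v ⊎ z ≡ w
  deg≤2⇒neighbour {u} {v} {w} {z} deg≤2 uv uw v≢w uz with z ≟ v | z ≟ w
  ... | yes z≡v | _ = inj₁ z≡v
  ... | no _ | yes z≡w = inj₂ z≡w
  ... | no z≢v | no z≢w = contradiction deg≤2 (<⇒≱ (length≤deg u distinct
          λ { (here refl) → uv ; (there (here refl)) → uw ; (there (there (here refl))) → uz }))
    where
    distinct : Unique (v ∷ w ∷ z ∷ [])
    distinct = (v≢w ∷ z≢v ∘ sym ∷ []) ∷ (z≢w ∘ sym ∷ []) ∷ [] ∷ []

  another-neighbour : ∀ {u} v → 2 ≤ deg G u → ∃ λ w → w ≢ v × Edge G u w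
  another-neighbour {u} v 2≤deg
    with WithDecidableEquality.longer⇒∃∉ _≟_ {ys = [ v ]} (neighbours-unique u) 2≤deg
  ... | w , w∈nbrs , w∉[v] = w , w∉[v] ∘ here , ∈-neighbours⁻ w∈nbrs

_⊆ᴳ_ : Graph n → Graph n → Set
H ⊆ᴳ G = ∀ {u v} → Edge H u v → Edge G u v

module _ (H G : Graph n) (u : Fin n) (H⊆G : ∀ {v} → Edge H u v → Edge G u v) where

  deg-mono : deg H u ≤ deg G u
  deg-mono = deg≤length H u (∈-neighbours⁺ G ∘ H⊆G)

  deg-mono-< : ∀ {w} → Edge G u w → ¬ Edge H u w → deg H u < deg G u
  deg-mono-< uw ¬uw =
    length≤deg G u (All.tabulate (λ v∈ → ¬uw ∘ λ { refl → ∈-neighbours⁻ H v∈ }) ∷ neighbours-unique H u)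
      λ { (here refl) → uw ; (there v∈) → H⊆G (∈-neighbours⁻ H v∈) }

record EdgeSet (n : ℕ) : Set₁ where
  field
    Has     : Fin n → Fin n → Set
    has?    : ∀ u v → Dec (Has u v)
    Has-sym : ∀ {u v} → Has u v → Has v u

open EdgeSet public

⟦_,_⟧ : Fin n → Fin n → EdgeSet n
⟦ a , b ⟧ = record
  { Has     = λ u v → (u ≡ a × v ≡ b) ⊎ (u ≡ b × v ≡ a)
  ; has?    = λ u v → (u ≟ a ×-dec v ≟ b) ⊎-dec (u ≟ b ×-dec v ≟ a)
  ; Has-sym = [ (λ (p , q) → inj₂ (q , p)) , (λ (p , q) → inj₁ (q , p)) ]′
  }

star : Fin n → EdgeSet n
star x = record
  { Has     = λ u v → u ≡ x ⊎ v ≡ x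
  ; has?    = λ u v → u ≟ x ⊎-dec v ≟ x
  ; Has-sym = [ inj₂ , inj₁ ]′
  }

module _ {a b u v : Fin n} where

  ⟦⟧⊆star : Has ⟦ a , b ⟧ u v → Has (star a) u v
  ⟦⟧⊆star = [ inj₁ ∘ proj₁ , inj₂ ∘ proj₂ ]′

  ∉⟦⟧ : u ≢ a → u ≢ b → ¬ Has ⟦ a , b ⟧ u v
  ∉⟦⟧ u≢a u≢b = [ u≢a ∘ proj₁ , u≢b ∘ proj₁ ]′

isYes-cong : ∀ {P Q : Set} (p : Dec P) (q : Dec Q) → (P → Q) → (Q → P) → isYes p ≡ isYes q
isYes-cong (yes _) (yes _) _ _ = refl
isYes-cong (no _) (no _) _ _ = refl
isYes-cong (yes p) (no ¬q) P→Q _ = contradiction (P→Q p) ¬q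
isYes-cong (no ¬p) (yes q) _ Q→P = contradiction (Q→P q) ¬p

isYes-has-sym : ∀ (E : EdgeSet n) u v → isYes (has? E u v) ≡ isYes (has? E v u)
isYes-has-sym E u v = isYes-cong (has? E u v) (has? E v u) (Has-sym E) (Has-sym E)

-- Opaque, so that G and E can be inferred from the type Edge (G ∖ E) u v.
opaque
  _∖_ : Graph n → EdgeSet n → Graph n
  G ∖ E = record
    { adj        = λ u v → adj G u v ∧ not (isYes (has? E u v))
    ; adj-sym    = λ u v → cong₂ (λ b h → b ∧ not h) (adj-sym G u v) (isYes-has-sym E u v)
    ; adj-irrefl = λ u → cong (λ b → b ∧ not (isYes (has? E u u))) (adj-irrefl G u)
    }

  ∖-⊆ : ∀ {G : Graph n} {E u v} → Edge (G ∖ E) u v → Edge G u v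
  ∖-⊆ = proj₁ ∘ Equivalence.to T-∧

  ∖-∉ : ∀ {G : Graph n} {E u v} → Edge (G ∖ E) u v → ¬ Has E u v
  ∖-∉ {G = G} {E} {u} {v} e = toWitnessFalse {a? = has? E u v} (proj₂ (Equivalence.to (T-∧ {adj G u v}) e))

  ∖-intro : ∀ {G : Graph n} {E u v} → Edge G u v → ¬ Has E u v → Edge (G ∖ E) u v
  ∖-intro {G = G} {E} {u} {v} e ¬h =
    Equivalence.from (T-∧ {adj G u v}) (e , fromWitnessFalse {a? = has? E u v} ¬h)

  add-edge : (G : Graph n) {a b : Fin n} → a ≢ b → Graph n
  add-edge G {a} {b} a≢b = record
    { adj        = λ u v → adj G u v ∨ isYes (has? ⟦ a , b ⟧ u v)
    ; adj-sym    = λ u v → cong₂ _∨_ (adj-sym G u v) (isYes-has-sym ⟦ a , b ⟧ u v)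
    ; adj-irrefl = λ u → cong₂ _∨_ (adj-irrefl G u) (isYes-cong (has? ⟦ a , b ⟧ u u) (no λ ()) not-loop λ ())
    }
    where
    not-loop : ∀ {u} → Has ⟦ a , b ⟧ u u → ⊥
    not-loop (inj₁ (refl , refl)) = a≢b refl
    not-loop (inj₂ (refl , refl)) = a≢b refl

  add-edge-cases : ∀ {G : Graph n} {a b} {a≢b : a ≢ b} {u v}
                 → Edge (add-edge G a≢b) u v → Edge G u v ⊎ Has ⟦ a , b ⟧ u v
  add-edge-cases e with Equivalence.to T-∨ e
  ... | inj₁ old = inj₁ old
  ... | inj₂ new = inj₂ (toWitness new)

  add-edge-old : ∀ {G : Graph n} {a b} {a≢b : a ≢ b} {u v} → Edge G u v → Edge (add-edge G a≢b) u v
  add-edge-old {G = G} {a} {b} {u = u} {v} = Equivalence.from (T-∨ {adj G u v} {isYes (has? ⟦ a , b ⟧ u v)}) ∘ inj₁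

  add-edge-new : ∀ {G : Graph n} {a b} {a≢b : a ≢ b} {u v} → Has ⟦ a , b ⟧ u v → Edge (add-edge G a≢b) u v
  add-edge-new {G = G} {a} {b} {u = u} {v} =
    Equivalence.from (T-∨ {adj G u v}) ∘ inj₂ ∘ fromWitness {a? = has? ⟦ a , b ⟧ u v}

module _ {A : Set} (E : EdgeSet n) where

  opaque
    select : (Fin n → Fin n → A) → (Fin n → Fin n → A) → Fin n → Fin n → A
    select f g u v with has? E u v
    ... | yes _ = f u v
    ... | no _ = g u v

    select-elim : ∀ (P : A → Set) {f g u v} → (Has E u v → P (f u v)) → (¬ Has E u v → P (g u v))
                → P (select f g u v)
    select-elim P {u = u} {v} on-E off-E with has? E u v
    ... | yes h = on-E h
    ... | no ¬h = off-E ¬h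

  select-∈ : ∀ {f g u v} → Has E u v → select f g u v ≡ f u v
  select-∈ h = select-elim (_≡ _) (λ _ → refl) (contradiction h)

  select-∉ : ∀ {f g u v} → ¬ Has E u v → select f g u v ≡ g u v
  select-∉ ¬h = select-elim (_≡ _) (λ h → contradiction h ¬h) (λ _ → refl)

  select-sym : ∀ {f g u v} → (Has E u v → f u v ≡ f v u) → (¬ Has E u v → g u v ≡ g v u)
             → select f g u v ≡ select f g v u
  select-sym {f} {g} {u} {v} on-E off-E =
    select-elim (_≡ select f g v u) (λ h → trans (on-E h) (sym (select-∈ {f = f} {g} (Has-sym E h))))
                                    (λ ¬h → trans (off-E ¬h) (sym (select-∉ {f = f} {g} (¬h ∘ Has-sym E))))

_[_≔_] : ∀ {A : Set} → (Fin n → Fin n → A) → EdgeSet n → A → Fin n → Fin n → A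
f [ E ≔ x ] = select E (λ _ _ → x) f

Lists : ℕ → Set
Lists n = Fin n → Fin n → List ℕ

IsColouring : Graph n → Lists n → (Fin n → Fin n → ℕ) → Set
IsColouring G L π =
    (∀ u v → Edge G u v → π u v ≡ π v u)
  × (∀ u v w → Edge G u v → Edge G u w → ¬ v ≡ w → ¬ π u v ≡ π u w)
  × (∀ u v → Edge G u v → π u v ∈ L u v)

Colourable : Graph n → Lists n → Set
Colourable {n} G L = ∃ λ (π : Fin n → Fin n → ℕ) → IsColouring G L π

colouring-mono : ∀ {G H : Graph n} {L L′ π} → H ⊆ᴳ G → (∀ {u v} → Edge H u v → L u v ⊆ L′ u v)
               → IsColouring G L π → IsColouring H L′ π
colouring-mono H⊆G L⊆L′ (π-sym , π-proper , π-in) =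
    (λ u v e → π-sym u v (H⊆G e))
  , (λ u v w uv uw → π-proper u v w (H⊆G uv) (H⊆G uw))
  , (λ u v e → L⊆L′ e (π-in u v (H⊆G e)))

edgeless-colourable : ∀ {G : Graph n} {L} → (∀ u v → ¬ Edge G u v) → Colourable G L
edgeless-colourable no-edge =
  (λ _ _ → 0) , (λ u v → ⊥-elim ∘ no-edge u v) , (λ u v _ → ⊥-elim ∘ no-edge u v) , (λ u v → ⊥-elim ∘ no-edge u v)

module _ {G H : Graph n} {L : Lists n} {π : Fin n → Fin n → ℕ} {a b : Fin n} {c : ℕ} where

  extend-edge : H ⊆ᴳ G → (∀ {u v} → Edge G u v → ¬ Has ⟦ a , b ⟧ u v → Edge H u v)
         → Edge G a b → L a b ≡ L b a → c ∈ L a b → IsColouring H L π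
         → (∀ {z} → Edge H a z → π a z ≢ c) → (∀ {z} → Edge H b z → π b z ≢ c)
         → IsColouring G L (π [ ⟦ a , b ⟧ ≔ c ])
  extend-edge H⊆G rest ab Lab≡Lba c∈Lab (π-sym , π-proper , π-in) a-free b-free = π′-sym , π′-proper , π′-in
    where
    π′ = π [ ⟦ a , b ⟧ ≔ c ]
    new : ∀ {u v} → Has ⟦ a , b ⟧ u v → π′ u v ≡ c
    new = select-∈ ⟦ a , b ⟧
    old : ∀ {u v} → ¬ Has ⟦ a , b ⟧ u v → π′ u v ≡ π u v
    old = select-∉ ⟦ a , b ⟧
    end-free : ∀ {u v z} → Has ⟦ a , b ⟧ u v → Edge H u z → π u z ≢ c
    end-free (inj₁ (refl , _)) = a-free
    end-free (inj₂ (refl , _)) = b-free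
    same-edge : ∀ {u v w} → Has ⟦ a , b ⟧ u v → Has ⟦ a , b ⟧ u w → v ≡ w
    same-edge (inj₁ (refl , refl)) (inj₁ (_ , refl)) = refl
    same-edge (inj₂ (refl , refl)) (inj₂ (_ , refl)) = refl
    same-edge (inj₁ (refl , refl)) (inj₂ (a≡b , refl)) = contradiction a≡b (Edge⇒≢ G ab)
    same-edge (inj₂ (a≡b , refl)) (inj₁ (refl , refl)) = contradiction a≡b (Edge⇒≢ G ab)
    π′-sym : ∀ u v → Edge G u v → π′ u v ≡ π′ v u
    π′-sym u v e = select-sym ⟦ a , b ⟧ (λ _ → refl) (λ ¬h → π-sym u v (rest e ¬h))
    π′-proper : ∀ u v w → Edge G u v → Edge G u w → v ≢ w → π′ u v ≢ π′ u w
    π′-proper u v w uv uw v≢w eq = by-cases (has? ⟦ a , b ⟧ u v) (has? ⟦ a , b ⟧ u w)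
      where
      by-cases : Dec (Has ⟦ a , b ⟧ u v) → Dec (Has ⟦ a , b ⟧ u w) → ⊥
      by-cases (yes h) (yes h′) = v≢w (same-edge h h′)
      by-cases (yes h) (no ¬h′) = end-free h (rest uw ¬h′) (trans (sym (old ¬h′)) (trans (sym eq) (new h)))
      by-cases (no ¬h) (yes h′) = end-free h′ (rest uv ¬h) (trans (sym (old ¬h)) (trans eq (new h′)))
      by-cases (no ¬h) (no ¬h′) =
        π-proper u v w (rest uv ¬h) (rest uw ¬h′) v≢w (trans (sym (old ¬h)) (trans eq (old ¬h′)))
    π′-in : ∀ u v → Edge G u v → π′ u v ∈ L u v
    π′-in u v e = select-elim ⟦ a , b ⟧ (_∈ L u v) on-edge (λ ¬h → π-in u v (rest e ¬h))
      where
      on-edge : Has ⟦ a , b ⟧ u v → c ∈ L u v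
      on-edge (inj₁ (refl , refl)) = c∈Lab
      on-edge (inj₂ (refl , refl)) = subst (c ∈_) Lab≡Lba c∈Lab

module _ {G : Graph n} {L : Lists n} {π : Fin n → Fin n → ℕ} {x v w : Fin n} {cv cw : ℕ} where

  extend-at-deg2 : deg G x ≤ 2 → Edge G x v → Edge G x w → v ≢ w → (∀ {p q} → Edge G p q → L p q ≡ L q p)
            → cv ∈ L x v → cw ∈ L x w → cv ≢ cw → IsColouring (G ∖ star x) L π
            → (∀ {z} → Edge (G ∖ star x) v z → π v z ≢ cv) → (∀ {z} → Edge (G ∖ star x) w z → π w z ≢ cw)
            → Colourable G L
  extend-at-deg2 deg≤2 xv xw v≢w L-sym cv∈ cw∈ cv≢cw π-ok v-free w-free =
    π₁ [ ⟦ x , v ⟧ ≔ cv ] ,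
    extend-edge {G = G} {H = G ∖ ⟦ x , v ⟧} ∖-⊆ ∖-intro xv (L-sym xv) cv∈ π₁-ok x-free v-free₁
    where
    π₁ = π [ ⟦ x , w ⟧ ≔ cw ]
    x≢v = Edge⇒≢ G xv
    x≢w = Edge⇒≢ G xw
    off-x : ∀ {p q} → Edge G p q → ¬ Has ⟦ x , v ⟧ p q → ¬ Has ⟦ x , w ⟧ p q → ¬ Has (star x) p q
    off-x e ¬xv ¬xw (inj₁ refl) with deg≤2⇒neighbour G deg≤2 xv xw v≢w e
    ... | inj₁ refl = ¬xv (inj₁ (refl , refl))
    ... | inj₂ refl = ¬xw (inj₁ (refl , refl))
    off-x e ¬xv ¬xw (inj₂ refl) with deg≤2⇒neighbour G deg≤2 xv xw v≢w (Edge-sym G e)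
    ... | inj₁ refl = ¬xv (inj₂ (refl , refl))
    ... | inj₂ refl = ¬xw (inj₂ (refl , refl))
    π₁-ok : IsColouring (G ∖ ⟦ x , v ⟧) L π₁
    π₁-ok = extend-edge {G = G ∖ ⟦ x , v ⟧} {H = G ∖ star x} (λ e → ∖-intro (∖-⊆ e) (∖-∉ e ∘ ⟦⟧⊆star))
                   (λ e ¬xw → ∖-intro (∖-⊆ e) (off-x (∖-⊆ e) (∖-∉ e) ¬xw))
                   (∖-intro xw [ v≢w ∘ sym ∘ proj₂ , x≢v ∘ proj₁ ]′)
                   (L-sym xw) cw∈ π-ok (λ e → contradiction (inj₁ refl) (∖-∉ e)) w-free
    x-free : ∀ {z} → Edge (G ∖ ⟦ x , v ⟧) x z → π₁ x z ≢ cv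
    x-free {z} e with deg≤2⇒neighbour G {z = z} deg≤2 xv xw v≢w (∖-⊆ e)
    ... | inj₁ refl = contradiction (inj₁ (refl , refl)) (∖-∉ e)
    ... | inj₂ refl = λ eq → cv≢cw (trans (sym eq) (select-∈ ⟦ x , w ⟧ (inj₁ (refl , refl))))
    v-free₁ : ∀ {z} → Edge (G ∖ ⟦ x , v ⟧) v z → π₁ v z ≢ cv
    v-free₁ {z} e eq =
      v-free (∖-intro (∖-⊆ e) [ x≢v ∘ sym , z≢x ]′) (trans (sym (select-∉ ⟦ x , w ⟧ (∉⟦⟧ (x≢v ∘ sym) v≢w))) eq)
      where
      z≢x : z ≢ x
      z≢x refl = ∖-∉ e (inj₂ (refl , refl))

remaining-neighbour : ∀ (G : Graph n) {u u′ v z} → deg G v ≤ 2 → Edge G v u → Edge G v u′ → u ≢ u′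
                    → Edge (G ∖ star u) v z → z ≡ u′
remaining-neighbour G deg≤2 vu vu′ u≢u′ e with deg≤2⇒neighbour G deg≤2 vu vu′ u≢u′ (∖-⊆ e)
... | inj₁ refl = contradiction (inj₂ refl) (∖-∉ e)
... | inj₂ z≡u′ = z≡u′

module _ {G : Graph n} {L : Lists n} {a b : Fin n} where

  extend-greedily : Edge G a b → L a b ≡ L b a → Unique (L a b) → deg G a + deg G b ≤ suc (length (L a b))
                  → Colourable (G ∖ ⟦ a , b ⟧) L → Colourable G L
  extend-greedily ab Lab≡Lba Lab! deg-sum≤ (π , π-ok) =
    π [ ⟦ a , b ⟧ ≔ c ] ,
    extend-edge {G = G} {H = H} ∖-⊆ ∖-intro ab Lab≡Lba c∈Lab π-ok (free ∈-++⁺ˡ) (free (∈-++⁺ʳ (seen a)))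
    where
    H = G ∖ ⟦ a , b ⟧
    seen : Fin n → List ℕ
    seen u = map (π u) (neighbours H u)
    seen<∣L∣ : length (seen a ++ seen b) < length (L a b)
    seen<∣L∣ = ≤-pred (begin
      suc (suc (length (seen a ++ seen b)))   ≡⟨ cong (suc ∘ suc) (length-++ (seen a)) ⟩
      suc (suc (length (seen a) + length (seen b)))
        ≡⟨ cong (suc ∘ suc) (cong₂ _+_ (length-map (π a) (neighbours H a)) (length-map (π b) (neighbours H b))) ⟩
      suc (suc (deg H a + deg H b))           ≡⟨ cong suc (+-suc (deg H a) (deg H b)) ⟨
      suc (deg H a) + suc (deg H b)
        ≤⟨ +-mono-≤ (deg-mono-< H G a ∖-⊆ ab (λ e → ∖-∉ e (inj₁ (refl , refl))))
                    (deg-mono-< H G b ∖-⊆ (Edge-sym G ab) (λ e → ∖-∉ e (inj₂ (refl , refl)))) ⟩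
      deg G a + deg G b                       ≤⟨ deg-sum≤ ⟩
      suc (length (L a b))                    ∎)
      where open ≤-Reasoning
    c-choice = longer⇒∃∉ Lab! seen<∣L∣
    c = proj₁ c-choice
    c∈Lab = proj₁ (proj₂ c-choice)
    free : ∀ {u z} → (π u z ∈ seen u → π u z ∈ seen a ++ seen b) → Edge H u z → π u z ≢ c
    free {u} into e eq =
      proj₂ (proj₂ c-choice) (subst (_∈ seen a ++ seen b) eq (into (∈-map⁺ (π u) (∈-neighbours⁺ H e))))

sum-map-≤ : ∀ {A : Set} {f g : A → ℕ} → (∀ x → f x ≤ g x) → ∀ xs → sum (map f xs) ≤ sum (map g xs)
sum-map-≤ f≤g [] = z≤n
sum-map-≤ f≤g (x ∷ xs) = +-mono-≤ (f≤g x) (sum-map-≤ f≤g xs)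

sum-map-< : ∀ {A : Set} {f g : A → ℕ} {a xs} → (∀ x → f x ≤ g x) → a ∈ xs → f a < g a
          → sum (map f xs) < sum (map g xs)
sum-map-< {xs = _ ∷ xs} f≤g (here refl) fa<ga = +-mono-<-≤ fa<ga (sum-map-≤ f≤g xs)
sum-map-< f≤g (there a∈xs) fa<ga = +-mono-≤-< (f≤g _) (sum-map-< f≤g a∈xs fa<ga)

degree-sum : Graph n → ℕ
degree-sum {n} G = sum (map (deg G) (allFin n))

_≺_ : Graph n → Graph n → Set
H ≺ G = degree-sum H < degree-sum G

≺-wellFounded : WellFounded (_≺_ {n})
≺-wellFounded = On.wellFounded degree-sum <-wellFounded

≺-by-deg : ∀ {H G : Graph n} {a} → (∀ u → deg H u ≤ deg G u) → deg H a < deg G a → H ≺ G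
≺-by-deg {H = H} {G} {a} deg≤ = sum-map-< {f = deg H} {g = deg G} deg≤ (∈-allFin a)

⊆-≺ : ∀ {H G : Graph n} {a b} → H ⊆ᴳ G → Edge G a b → ¬ Edge H a b → H ≺ G
⊆-≺ {H = H} {G} {a} H⊆G ab ¬ab = ≺-by-deg {H = H} {G} (λ u → deg-mono H G u H⊆G) (deg-mono-< H G a H⊆G ab ¬ab)

-- The induction invariant: the hypotheses of the theorem, for lists not tied to a fixed graph.
record Admissible (S : Fin n → Set) (G : Graph n) (L : Lists n) : Set where
  field
    lists-sym    : ∀ {u v} → Edge G u v → L u v ≡ L v u
    lists-unique : ∀ {u v} → Edge G u v → Unique (L u v)
    S-stable     : Stable G S
    high⇒S       : ∀ {u} → 3 ≤ deg G u → S u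
    S-uniform    : ∀ {u v w} → S u → Edge G u v → Edge G u w → L u v ≡ L u w
    deg≤∣L∣      : ∀ {u v} → Edge G u v → deg G u ≤ length (L u v)
    3≤∣L∣        : ∀ {u v} → Edge G u v → ¬ S u → ¬ S v → 3 ≤ length (L u v)

  ¬S⇒deg≤2 : ∀ {u} → ¬ S u → deg G u ≤ 2
  ¬S⇒deg≤2 ¬Su = ≤-pred (≰⇒> (¬Su ∘ high⇒S))

  S⇒¬S : ∀ {u v} → S u → Edge G u v → ¬ S v
  S⇒¬S Su uv Sv = S-stable _ _ Su Sv uv

admissible-⊆ : ∀ {S} {G H : Graph n} {L} → Admissible S G L → H ⊆ᴳ G → Admissible S H L
admissible-⊆ {G = G} {H} A H⊆G = record
  { lists-sym    = lists-sym ∘ H⊆G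
  ; lists-unique = lists-unique ∘ H⊆G
  ; S-stable     = λ u v Su Sv → S-stable u v Su Sv ∘ H⊆G
  ; high⇒S       = λ {u} 3≤deg → high⇒S (≤-trans 3≤deg (deg-mono H G u H⊆G))
  ; S-uniform    = λ Su uv uw → S-uniform Su (H⊆G uv) (H⊆G uw)
  ; deg≤∣L∣      = λ {u} uv → ≤-trans (deg-mono H G u H⊆G) (deg≤∣L∣ (H⊆G uv))
  ; 3≤∣L∣        = 3≤∣L∣ ∘ H⊆G
  }
  where open Admissible A

-- Deleting c from every list at x keeps c free at x for an edge added back later.
reserve : Fin n → ℕ → Lists n → Lists n
reserve x c L = select (star x) (λ u v → without c (L u v)) L

module _ {x : Fin n} {c d : ℕ} {L : Lists n} {u v : Fin n} where

  ∈-reserve⁻ : d ∈ reserve x c L u v → d ∈ L u v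
  ∈-reserve⁻ = select-elim (star x) (λ K → d ∈ K → d ∈ L u v) (λ _ → proj₁ ∘ ∈-without⁻ {xs = L u v}) (λ _ → id)

  ∈-reserve-at : Has (star x) u v → d ∈ reserve x c L u v → d ≢ c
  ∈-reserve-at h =
    select-elim (star x) (λ K → d ∈ K → d ≢ c) (λ _ → proj₂ ∘ ∈-without⁻ {xs = L u v}) (contradiction h)

reserve-admissible : ∀ {S} {G : Graph n} {L x} c → Admissible S G L → S x
                   → (∀ {b} → Edge G x b → deg G x < length (L x b))
                   → (∀ {b} → Edge G x b → 3 ≤ length (L x b))
                   → Admissible S G (reserve x c L)
reserve-admissible {S = S} {G} {L} {x} c A Sx x-deg< x-3≤ = record
  { lists-sym    = λ e → select-sym (star x) (λ _ → cong (without c) (lists-sym e)) (λ _ → lists-sym e)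
  ; lists-unique = λ e → select-elim (star x) Unique (λ _ → without-unique (lists-unique e)) (λ _ → lists-unique e)
  ; S-stable     = S-stable
  ; high⇒S       = high⇒S
  ; S-uniform    = uniform
  ; deg≤∣L∣      = λ {u} e → select-elim (star x) (λ K → deg G u ≤ length K)
                     (λ h → ≤-pred (<-≤-trans (deg<∣L∣ h e) (length-without (lists-unique e))))
                     (λ _ → deg≤∣L∣ e)
  ; 3≤∣L∣        = λ e ¬Su ¬Sv → select-elim (star x) (λ K → 3 ≤ length K)
                     [ (λ { refl → contradiction Sx ¬Su }) , (λ { refl → contradiction Sx ¬Sv }) ]′
                     (λ _ → 3≤∣L∣ e ¬Su ¬Sv)
  }
  where
  open Admissible A
  deg<∣L∣ : ∀ {u v} → Has (star x) u v → Edge G u v → deg G u < length (L u v)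
  deg<∣L∣ (inj₁ refl) e = x-deg< e
  deg<∣L∣ (inj₂ refl) e = <-≤-trans (s≤s (¬S⇒deg≤2 (S⇒¬S Sx (Edge-sym G e))))
                                    (subst (λ K → 3 ≤ length K) (lists-sym (Edge-sym G e)) (x-3≤ (Edge-sym G e)))
  uniform : ∀ {u v w} → S u → Edge G u v → Edge G u w → reserve x c L u v ≡ reserve x c L u w
  uniform {u} {v} {w} Su uv uw with u ≟ x
  ... | yes refl = begin
    reserve x c L x v  ≡⟨ select-∈ (star x) (inj₁ refl) ⟩
    without c (L x v)  ≡⟨ cong (without c) (S-uniform Su uv uw) ⟩
    without c (L x w)  ≡⟨ select-∈ (star x) (inj₁ refl) ⟨
    reserve x c L x w  ∎
    where open ≡-Reasoning
  ... | no u≢x = begin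
    reserve x c L u v  ≡⟨ select-∉ (star x) [ u≢x , (λ { refl → S⇒¬S Su uv Sx }) ]′ ⟩
    L u v              ≡⟨ S-uniform Su uv uw ⟩
    L u w              ≡⟨ select-∉ (star x) [ u≢x , (λ { refl → S⇒¬S Su uw Sx }) ]′ ⟨
    reserve x c L u w  ∎
    where open ≡-Reasoning

module _ {n : ℕ} {S : Fin n → Set} (S? : ∀ u → Dec (S u)) where

  module Reductions {G : Graph n} {L : Lists n} (A : Admissible S G L)
                    (ih : ∀ {H} → H ≺ G → ∀ L′ → Admissible S H L′ → Colourable H L′) where

    open Admissible A

    colour-subgraph : ∀ {H a b} → H ⊆ᴳ G → Edge G a b → ¬ Edge H a b → Colourable H L
    colour-subgraph {H} H⊆G ab ¬ab = ih {H} (⊆-≺ {H = H} {G} H⊆G ab ¬ab) L (admissible-⊆ A H⊆G)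

    by-deleting-edge : ∀ {a b} → Edge G a b → deg G a + deg G b ≤ suc (length (L a b)) → Colourable G L
    by-deleting-edge {a} {b} ab deg-sum≤ = extend-greedily {G = G} ab (lists-sym ab) (lists-unique ab) deg-sum≤
      (colour-subgraph {H = G ∖ ⟦ a , b ⟧} ∖-⊆ ab (λ e → ∖-∉ e (inj₁ (refl , refl))))

    by-pendant-edge : ∀ {a b} → Edge G a b → deg G b ≤ 1 → Colourable G L
    by-pendant-edge {a} ab deg≤1 =
      by-deleting-edge ab (≤-trans (+-mono-≤ (deg≤∣L∣ ab) deg≤1) (≤-reflexive (+-comm (length (L a _)) 1)))

    by-free-edge : ∀ {a b} → Edge G a b → ¬ S a → ¬ S b → Colourable G L
    by-free-edge ab ¬Sa ¬Sb =
      by-deleting-edge ab (≤-trans (+-mono-≤ (¬S⇒deg≤2 ¬Sa) (¬S⇒deg≤2 ¬Sb)) (s≤s (3≤∣L∣ ab ¬Sa ¬Sb)))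

    2≤∣L∣ : ∀ {u u′ v} → Edge G u v → Edge G u′ v → u ≢ u′ → 2 ≤ length (L u v)
    2≤∣L∣ uv u′v u≢u′ = ≤-trans (2≤deg G (Edge-sym G uv) (Edge-sym G u′v) u≢u′)
                          (subst (λ K → _ ≤ length K) (lists-sym (Edge-sym G uv)) (deg≤∣L∣ (Edge-sym G uv)))

    by-reserving-colours : ∀ {u u′ v} → S u → S u′ → Edge G u v → Edge G u′ v → u ≢ u′
                         → 3 ≤ length (L u v) → 3 ≤ length (L u′ v) → Colourable G L
    by-reserving-colours {u} {u′} {v} Su Su′ uv u′v u≢u′ 3≤Luv 3≤Lu′v =
      finish (ih {H} (⊆-≺ {H = H} {G} ∖-⊆ uv (λ e → ∖-∉ e (inj₂ refl))) L₂ A₂)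
      where
      H = G ∖ star v
      c-choice = longer⇒∃∉ {ys = []} (lists-unique uv) (≤-trans (s≤s z≤n) 3≤Luv)
      c = proj₁ c-choice
      c′-choice = longer⇒∃∉ {ys = [ c ]} (lists-unique u′v) (≤-trans (s≤s (s≤s z≤n)) 3≤Lu′v)
      c′ = proj₁ c′-choice
      L₁ = reserve u c L
      L₂ = reserve u′ c′ L₁
      deg< : ∀ {y b} → Edge G y v → Edge H y b → deg H y < length (L y b)
      deg< {y} yv yb = <-≤-trans (deg-mono-< H G y ∖-⊆ yv (λ e → ∖-∉ e (inj₂ refl))) (deg≤∣L∣ (∖-⊆ yb))
      3≤ : ∀ {y b} → S y → Edge G y v → 3 ≤ length (L y v) → Edge H y b → 3 ≤ length (L y b)
      3≤ Sy yv 3≤Lyv yb = subst (λ K → 3 ≤ length K) (S-uniform Sy yv (∖-⊆ yb)) 3≤Lyv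
      L₁≡L-at-u′ : ∀ {b} → Edge H u′ b → L₁ u′ b ≡ L u′ b
      L₁≡L-at-u′ u′b = select-∉ (star u) [ u≢u′ ∘ sym , (λ { refl → S-stable u′ u Su′ Su (∖-⊆ u′b) }) ]′
      A₁ : Admissible S H L₁
      A₁ = reserve-admissible c (admissible-⊆ A ∖-⊆) Su (deg< uv) (3≤ Su uv 3≤Luv)
      A₂ : Admissible S H L₂
      A₂ = reserve-admissible c′ A₁ Su′
             (λ u′b → subst (λ K → _ < length K) (sym (L₁≡L-at-u′ u′b)) (deg< u′v u′b))
             (λ u′b → subst (λ K → 3 ≤ length K) (sym (L₁≡L-at-u′ u′b)) (3≤ Su′ u′v 3≤Lu′v u′b))
      finish : Colourable H L₂ → Colourable G L
      finish (π , π-ok@(_ , _ , π-in)) =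
        extend-at-deg2 (¬S⇒deg≤2 (S⇒¬S Su uv)) (Edge-sym G uv) (Edge-sym G u′v) u≢u′ lists-sym
          (subst (c ∈_) (lists-sym uv) (proj₁ (proj₂ c-choice)))
          (subst (c′ ∈_) (lists-sym u′v) (proj₁ (proj₂ c′-choice)))
          (λ c≡c′ → proj₂ (proj₂ c′-choice) (here (sym c≡c′)))
          (colouring-mono {G = H} {H} (λ e → e) (λ _ → ∈-reserve⁻ ∘ ∈-reserve⁻) π-ok)
          (λ {z} uz → ∈-reserve-at (inj₁ refl) (∈-reserve⁻ (π-in u z uz)))
          (λ {z} u′z → ∈-reserve-at (inj₁ refl) (π-in u′ z u′z))

    extend-around : ∀ {π u u′ u″ v w} → S u → Edge G u v → Edge G u w → v ≢ w → Edge G u′ v → Edge G u″ w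
                  → u ≢ u′ → u ≢ u″ → length (L u v) ≤ 2 → IsColouring (G ∖ star u) L π → π v u′ ≢ π w u″
                  → Colourable G L
    extend-around {π} {u} {u′} {u″} {v} {w} Su uv uw v≢w u′v u″w u≢u′ u≢u″ ∣L∣≤2 π-ok α≢β =
      use (pair-avoiding (lists-unique uv) (2≤∣L∣ uv u′v u≢u′) α≢β)
      where
      use : (∃₂ λ x y → x ∈ L u v × y ∈ L u v × x ≢ y × x ≢ π v u′ × y ≢ π w u″) → Colourable G L
      use (x , y , x∈ , y∈ , x≢y , x≢α , y≢β) =
        extend-at-deg2 (≤-trans (deg≤∣L∣ uv) ∣L∣≤2) uv uw v≢w lists-sym x∈ (subst (y ∈_) (S-uniform Su uv uw) y∈) x≢y
          π-ok v-free w-free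
        where
        v-free : ∀ {z} → Edge (G ∖ star u) v z → π v z ≢ x
        v-free {z} e
          with remaining-neighbour G {z = z} (¬S⇒deg≤2 (S⇒¬S Su uv)) (Edge-sym G uv) (Edge-sym G u′v) u≢u′ e
        ... | refl = x≢α ∘ sym
        w-free : ∀ {z} → Edge (G ∖ star u) w z → π w z ≢ y
        w-free {z} e
          with remaining-neighbour G {z = z} (¬S⇒deg≤2 (S⇒¬S Su uw)) (Edge-sym G uw) (Edge-sym G u″w) u≢u″ e
        ... | refl = y≢β ∘ sym

    by-four-cycle : ∀ {u u′ v w} → S u → Edge G u v → Edge G u w → v ≢ w → Edge G u′ v → Edge G u′ w → u ≢ u′
                  → length (L u v) ≤ 2 → Colourable G L
    by-four-cycle {u} {u′} {v} {w} Su uv uw v≢w u′v u′w u≢u′ ∣L∣≤2 =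
      finish (colour-subgraph {H = G ∖ star u} ∖-⊆ uv (λ e → ∖-∉ e (inj₁ refl)))
      where
      finish : Colourable (G ∖ star u) L → Colourable G L
      finish (π , π-ok@(π-sym , π-proper , _)) =
        extend-around Su uv uw v≢w u′v u′w u≢u′ u≢u′ ∣L∣≤2 π-ok λ α≡β →
          π-proper u′ v w u′v₀ u′w₀ v≢w (trans (π-sym u′ v u′v₀) (trans α≡β (sym (π-sym u′ w u′w₀))))
        where
        u′v₀ = ∖-intro {E = star u} u′v [ u≢u′ ∘ sym , Edge⇒≢ G uv ∘ sym ]′
        u′w₀ = ∖-intro {E = star u} u′w [ u≢u′ ∘ sym , Edge⇒≢ G uw ∘ sym ]′

    module Shortcut {u u′ u″ v w} (Su : S u) (Su″ : S u″)
                    (uv : Edge G u v) (uw : Edge G u w) (v≢w : v ≢ w) (u′v : Edge G u′ v) (u″w : Edge G u″ w)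
                    (u≢u′ : u ≢ u′) (u≢u″ : u ≢ u″) (u′≢u″ : u′ ≢ u″) (∣L∣≤2 : length (L u v) ≤ 2) where

      ¬Sv = S⇒¬S Su uv
      v≢u″ : v ≢ u″
      v≢u″ refl = ¬Sv Su″
      deg-v≤2 = ¬S⇒deg≤2 ¬Sv
      deg-w≤2 = ¬S⇒deg≤2 (S⇒¬S Su uw)

      ¬vu″ : ¬ Edge G v u″
      ¬vu″ vu″ with deg≤2⇒neighbour G deg-v≤2 (Edge-sym G uv) (Edge-sym G u′v) u≢u′ vu″
      ... | inj₁ u″≡u = u≢u″ (sym u″≡u)
      ... | inj₂ u″≡u′ = u′≢u″ (sym u″≡u′)

      not-shortcut : ∀ {p q} → Edge G p q → ¬ Has ⟦ v , u″ ⟧ p q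
      not-shortcut pq (inj₁ (refl , refl)) = ¬vu″ pq
      not-shortcut pq (inj₂ (refl , refl)) = ¬vu″ (Edge-sym G pq)

      -- The path v – u – w – u″ becomes one edge vu″ with the list of wu″.
      H = G ∖ star u
      H₀ = H ∖ ⟦ w , u″ ⟧
      Gₛ = add-edge H₀ v≢u″
      Lₛ = L [ ⟦ v , u″ ⟧ ≔ L u″ w ]

      H₀⊆G : H₀ ⊆ᴳ G
      H₀⊆G = ∖-⊆ ∘ ∖-⊆

      old : ∀ {p q} → Edge Gₛ p q → ¬ Has ⟦ v , u″ ⟧ p q → Edge G p q
      old pq ¬new with add-edge-cases pq
      ... | inj₁ pq₀ = H₀⊆G pq₀
      ... | inj₂ new = contradiction new ¬new

      degₛ-v : deg Gₛ v ≤ 2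
      degₛ-v = deg≤length Gₛ v {ys = u′ ∷ u″ ∷ []} neighbour
        where
        neighbour : ∀ {z} → Edge Gₛ v z → z ∈ u′ ∷ u″ ∷ []
        neighbour {z} vz with add-edge-cases vz
        ... | inj₂ (inj₁ (_ , refl)) = there (here refl)
        ... | inj₂ (inj₂ (v≡u″ , _)) = contradiction v≡u″ v≢u″
        ... | inj₁ vz₀ =
          here (remaining-neighbour G {z = z} deg-v≤2 (Edge-sym G uv) (Edge-sym G u′v) u≢u′ (∖-⊆ vz₀))

      degₛ-u″ : deg Gₛ u″ ≤ deg G u″
      degₛ-u″ = ≤-trans (deg≤length Gₛ u″ {ys = v ∷ neighbours H₀ u″} neighbour)
                        (deg-mono-< H₀ G u″ H₀⊆G u″w (λ e → ∖-∉ e (inj₂ (refl , refl))))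
        where
        neighbour : ∀ {z} → Edge Gₛ u″ z → z ∈ v ∷ neighbours H₀ u″
        neighbour u″z with add-edge-cases u″z
        ... | inj₁ u″z₀ = there (∈-neighbours⁺ H₀ u″z₀)
        ... | inj₂ (inj₁ (u″≡v , _)) = contradiction (sym u″≡v) v≢u″
        ... | inj₂ (inj₂ (_ , refl)) = here refl

      degₛ≤ : ∀ p → deg Gₛ p ≤ deg G p
      degₛ≤ p with p ≟ v | p ≟ u″
      ... | yes refl | _ = ≤-trans degₛ-v (2≤deg G (Edge-sym G uv) (Edge-sym G u′v) u≢u′)
      ... | no _ | yes refl = degₛ-u″
      ... | no p≢v | no p≢u″ = deg-mono Gₛ G p (λ e → old e (∉⟦⟧ p≢v p≢u″))

      Gₛ≺G : Gₛ ≺ G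
      Gₛ≺G = ≺-by-deg {H = Gₛ} {G} degₛ≤ (deg-mono-< Gₛ G u (λ e → old e u∉) uv ¬uvₛ)
        where
        u∉ : ∀ {z} → ¬ Has ⟦ v , u″ ⟧ u z
        u∉ = ∉⟦⟧ (Edge⇒≢ G uv) u≢u″
        ¬uvₛ : ¬ Edge Gₛ u v
        ¬uvₛ uvₛ with add-edge-cases uvₛ
        ... | inj₁ uv₀ = ∖-∉ (∖-⊆ uv₀) (inj₁ refl)
        ... | inj₂ new = u∉ new

      lists-at-u″ : ∀ {q} → Edge Gₛ u″ q → Lₛ u″ q ≡ L u″ w
      lists-at-u″ u″q =
        select-elim ⟦ v , u″ ⟧ (_≡ L u″ w) (λ _ → refl) (λ ¬new → S-uniform Su″ (old u″q ¬new) u″w)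

      Aₛ : Admissible S Gₛ Lₛ
      Aₛ = record
        { lists-sym    = λ e → select-sym ⟦ v , u″ ⟧ (λ _ → refl) (lists-sym ∘ old e)
        ; lists-unique = λ e → select-elim ⟦ v , u″ ⟧ Unique (λ _ → lists-unique u″w) (lists-unique ∘ old e)
        ; S-stable     = stable
        ; high⇒S       = λ {p} 3≤deg → high⇒S (≤-trans 3≤deg (degₛ≤ p))
        ; S-uniform    = uniform
        ; deg≤∣L∣      = λ {p} e → select-elim ⟦ v , u″ ⟧ (λ K → deg Gₛ p ≤ length K) deg≤∣Lₛ∣
                           (λ ¬new → ≤-trans (degₛ≤ p) (deg≤∣L∣ (old e ¬new)))
        ; 3≤∣L∣        = λ e ¬Sp ¬Sq → select-elim ⟦ v , u″ ⟧ (λ K → 3 ≤ length K)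
                           [ (λ { (_ , refl) → contradiction Su″ ¬Sq }) , (λ { (refl , _) → contradiction Su″ ¬Sp }) ]′
                           (λ ¬new → 3≤∣L∣ (old e ¬new) ¬Sp ¬Sq)
        }
        where
        stable : Stable Gₛ S
        stable p q Sp Sq pq with add-edge-cases pq
        ... | inj₁ pq₀ = S-stable p q Sp Sq (H₀⊆G pq₀)
        ... | inj₂ (inj₁ (refl , _)) = ¬Sv Sp
        ... | inj₂ (inj₂ (_ , refl)) = ¬Sv Sq
        uniform : ∀ {p q q′} → S p → Edge Gₛ p q → Edge Gₛ p q′ → Lₛ p q ≡ Lₛ p q′
        uniform {p} {q} {q′} Sp pq pq′ with p ≟ u″
        ... | yes refl = trans (lists-at-u″ pq) (sym (lists-at-u″ pq′))
        ... | no p≢u″ = begin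
          Lₛ p q   ≡⟨ select-∉ ⟦ v , u″ ⟧ p∉ ⟩
          L p q    ≡⟨ S-uniform Sp (old pq p∉) (old pq′ p∉) ⟩
          L p q′   ≡⟨ select-∉ ⟦ v , u″ ⟧ p∉ ⟨
          Lₛ p q′  ∎
          where
          open ≡-Reasoning
          p∉ : ∀ {z} → ¬ Has ⟦ v , u″ ⟧ p z
          p∉ = ∉⟦⟧ (λ { refl → ¬Sv Sp }) p≢u″
        deg≤∣Lₛ∣ : ∀ {p q} → Has ⟦ v , u″ ⟧ p q → deg Gₛ p ≤ length (L u″ w)
        deg≤∣Lₛ∣ (inj₁ (refl , refl)) = ≤-trans degₛ-v (2≤∣L∣ u″w uw (u≢u″ ∘ sym))
        deg≤∣Lₛ∣ (inj₂ (refl , refl)) = ≤-trans degₛ-u″ (deg≤∣L∣ u″w)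

      finish : Colourable Gₛ Lₛ → Colourable G L
      finish (π , π-ok@(π-sym , π-proper , π-in)) =
        extend-around Su uv uw v≢w u′v u″w u≢u′ u≢u″ ∣L∣≤2 π₁-ok
          λ α≡β → α≢β (trans (sym π₁-vu′) (trans α≡β π₁-wu″))
        where
        vu′ₛ : Edge Gₛ v u′
        vu′ₛ = add-edge-old (∖-intro (∖-intro (Edge-sym G u′v) [ Edge⇒≢ G uv ∘ sym , u≢u′ ∘ sym ]′)
                                     (∉⟦⟧ v≢w v≢u″))
        vu″ₛ : Edge Gₛ v u″
        vu″ₛ = add-edge-new (inj₁ (refl , refl))
        β = π v u″
        α≢β : π v u′ ≢ β
        α≢β = π-proper v u′ u″ vu′ₛ vu″ₛ u′≢u″
        π₁ = π [ ⟦ w , u″ ⟧ ≔ β ]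
        π₁-vu′ : π₁ v u′ ≡ π v u′
        π₁-vu′ = select-∉ ⟦ w , u″ ⟧ (∉⟦⟧ v≢w v≢u″)
        π₁-wu″ : π₁ w u″ ≡ β
        π₁-wu″ = select-∈ ⟦ w , u″ ⟧ (inj₁ (refl , refl))
        π₁-ok : IsColouring H L π₁
        π₁-ok = extend-edge {G = H} {H = H₀} ∖-⊆ ∖-intro wu″ (lists-sym (Edge-sym G u″w)) β∈ π₀-ok w-free u″-free
          where
          wu″ : Edge H w u″
          wu″ = ∖-intro (Edge-sym G u″w) [ Edge⇒≢ G uw ∘ sym , u≢u″ ∘ sym ]′
          β∈ : β ∈ L w u″
          β∈ = subst (β ∈_) (trans (select-∈ ⟦ v , u″ ⟧ (inj₁ (refl , refl))) (lists-sym u″w)) (π-in v u″ vu″ₛ)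
          π₀-ok : IsColouring H₀ L π
          π₀-ok = colouring-mono {G = Gₛ} {H₀} add-edge-old
                    (λ e → subst (_ ∈_) (select-∉ ⟦ v , u″ ⟧ (not-shortcut (H₀⊆G e)))) π-ok
          w-free : ∀ {z} → Edge H₀ w z → π w z ≢ β
          w-free {z} e with remaining-neighbour G {z = z} deg-w≤2 (Edge-sym G uw) (Edge-sym G u″w) u≢u″ (∖-⊆ e)
          ... | refl = contradiction (inj₁ (refl , refl)) (∖-∉ e)
          u″-free : ∀ {z} → Edge H₀ u″ z → π u″ z ≢ β
          u″-free {z} e eq = π-proper u″ v z u″vₛ (add-edge-old e) v≢z (trans (π-sym u″ v u″vₛ) (sym eq))
            where
            u″vₛ = add-edge-new {a≢b = v≢u″} (inj₂ (refl , refl))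
            v≢z : v ≢ z
            v≢z refl = ¬vu″ (Edge-sym G (H₀⊆G e))

      colouring : Colourable G L
      colouring = finish (ih {Gₛ} Gₛ≺G Lₛ Aₛ)

    at-short-list : ∀ {u u′ v} → S u → S u′ → Edge G u v → Edge G u′ v → u ≢ u′ → length (L u v) ≤ 2
                      → Colourable G L
    at-short-list {u} {u′} {v} Su Su′ uv u′v u≢u′ ∣L∣≤2 with deg G u ≤? 1
    ... | yes deg-u≤1 = by-pendant-edge (Edge-sym G uv) deg-u≤1
    ... | no deg-u≰1 with another-neighbour G v (≰⇒> deg-u≰1)
    ...   | w , w≢v , uw with deg G w ≤? 1
    ...     | yes deg-w≤1 = by-pendant-edge uw deg-w≤1
    ...     | no deg-w≰1 with another-neighbour G u (≰⇒> deg-w≰1)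
    ...       | u″ , u″≢u , wu″ with S? u″
    ...         | no ¬Su″ = by-free-edge wu″ (S⇒¬S Su uw) ¬Su″
    ...         | yes Su″ with u″ ≟ u′
    ...           | yes refl = by-four-cycle Su uv uw (w≢v ∘ sym) u′v (Edge-sym G wu″) u≢u′ ∣L∣≤2
    ...           | no u″≢u′ = Shortcut.colouring Su Su″ uv uw (w≢v ∘ sym) u′v (Edge-sym G wu″)
                                 u≢u′ (u″≢u ∘ sym) (u″≢u′ ∘ sym) ∣L∣≤2

    at-S-path : ∀ {u u′ v} → S u → S u′ → Edge G u v → Edge G u′ v → u ≢ u′ → Colourable G L
    at-S-path {u} {u′} {v} Su Su′ uv u′v u≢u′ with length (L u v) ≤? 2 | length (L u′ v) ≤? 2
    ... | yes short | _ = at-short-list Su Su′ uv u′v u≢u′ short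
    ... | no _ | yes short = at-short-list Su′ Su u′v uv (u≢u′ ∘ sym) short
    ... | no long | no long′ = by-reserving-colours Su Su′ uv u′v u≢u′ (≰⇒> long) (≰⇒> long′)

    at-S-edge : ∀ {u v} → S u → Edge G u v → Colourable G L
    at-S-edge {u} {v} Su uv with deg G v ≤? 1
    ... | yes deg≤1 = by-pendant-edge uv deg≤1
    ... | no deg≰1 with another-neighbour G u (≰⇒> deg≰1)
    ...   | u′ , u′≢u , vu′ with S? u′
    ...     | no ¬Su′ = by-free-edge vu′ (S⇒¬S Su uv) ¬Su′
    ...     | yes Su′ = at-S-path Su Su′ uv (Edge-sym G vu′) (u′≢u ∘ sym)

    colourable-by-reduction : Colourable G L
    colourable-by-reduction with any? (λ u → any? (λ v → T? (adj G u v)))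
    ... | no no-edge = edgeless-colourable {G = G} (λ u v uv → no-edge (u , v , uv))
    ... | yes (u , v , uv) with S? u | S? v
    ...   | yes Su | yes Sv = contradiction uv (S-stable u v Su Sv)
    ...   | yes Su | no _ = at-S-edge Su uv
    ...   | no _ | yes Sv = at-S-edge Sv (Edge-sym G uv)
    ...   | no ¬Su | no ¬Sv = by-free-edge uv ¬Su ¬Sv

  colourable : ∀ G L → Admissible S G L → Colourable G L
  colourable = WF.All.wfRec ≺-wellFounded 0ℓ (λ G → ∀ L → Admissible S G L → Colourable G L)
                 (λ G ih L A → Reductions.colourable-by-reduction A ih)

¬¬-subset : ∀ {n} (P : Fin n → Set) → ¬ ¬ (∃ λ X → ∀ i → P i ⇔ i ∈ˢ X)
¬¬-subset {zero} P no-X = no-X ([] , λ ())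
¬¬-subset {suc n} P no-X = ¬¬-excluded-middle λ P0? → ¬¬-subset (P ∘ Fin.suc) (no-X ∘ add P0?)
  where
  add : Dec (P Fin.zero) → (∃ λ X → ∀ i → P (Fin.suc i) ⇔ i ∈ˢ X) → ∃ λ X → ∀ i → P i ⇔ i ∈ˢ X
  add (yes P0) (X , P⇔X) = inside ∷ X , λ where
    Fin.zero → mk⇔ (λ _ → here) (λ _ → P0)
    (Fin.suc i) → mk⇔ (there ∘ Equivalence.to (P⇔X i)) λ { (there i∈X) → Equivalence.from (P⇔X i) i∈X }
  add (no ¬P0) (X , P⇔X) = outside ∷ X , λ where
    Fin.zero → mk⇔ (λ P0 → contradiction P0 ¬P0) λ ()
    (Fin.suc i) → mk⇔ (there ∘ Equivalence.to (P⇔X i)) λ { (there i∈X) → Equivalence.from (P⇔X i) i∈X }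

module _ {n} (G : Graph n) (𝓛 : ListAssignment G) where

  Conditions : (Fin n → Set) → Set
  Conditions S = Stable G S
               × (∀ u → 3 ≤ deg G u → S u)
               × (∀ u v w → S u → Edge G u v → Edge G u w → L 𝓛 u v ≡ L 𝓛 u w)
               × (∀ u v → Edge G u v → ¬ S u → ¬ S v → 3 ≤ ∣L∣ 𝓛 u v)

  conditions? : ∀ {S} → (∀ u → Dec (S u)) → Dec (Conditions S)
  conditions? S? =
          all? (λ u → all? λ v → S? u →-dec (S? v →-dec ¬? (T? (adj G u v))))
    ×-dec all? (λ u → (3 ≤? deg G u) →-dec S? u)
    ×-dec all? (λ u → all? λ v → all? λ w →
             S? u →-dec (T? (adj G u v) →-dec (T? (adj G u w) →-dec ≡-dec Data.Nat._≟_ (L 𝓛 u v) (L 𝓛 u w))))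
    ×-dec all? (λ u → all? λ v → T? (adj G u v) →-dec (¬? (S? u) →-dec (¬? (S? v) →-dec (3 ≤? ∣L∣ 𝓛 u v))))

  conditions-resp : ∀ {S S′} → (∀ u → S u ⇔ S′ u) → Conditions S → Conditions S′
  conditions-resp S⇔S′ (stable , high⇒S , uniform , free) =
      (λ u v S′u S′v → stable u v (from u S′u) (from v S′v))
    , (λ u 3≤deg → to u (high⇒S u 3≤deg))
    , (λ u v w S′u → uniform u v w (from u S′u))
    , (λ u v uv ¬S′u ¬S′v → free u v uv (¬S′u ∘ to u) (¬S′v ∘ to v))
    where
    to = λ u → Equivalence.to (S⇔S′ u)
    from = λ u → Equivalence.from (S⇔S′ u)

  admissible : ∀ {S} → Conditions S → (∀ u v → Edge G u v → deg G u ⊔ deg G v ≤ ∣L∣ 𝓛 u v)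
             → Admissible S G (L 𝓛)
  admissible (stable , high⇒S , uniform , free) size = record
    { lists-sym    = L-sym 𝓛 _ _
    ; lists-unique = L-unique 𝓛 _ _
    ; S-stable     = stable
    ; high⇒S       = high⇒S _
    ; S-uniform    = uniform _ _ _
    ; deg≤∣L∣      = λ e → ≤-trans (m≤m⊔n _ _) (size _ _ e)
    ; 3≤∣L∣        = free _ _
    }

lemma7 : ∀ {n} (G : Graph n) (𝓛 : ListAssignment G) (S : Fin n → Set)
    → TwoSparse G
    → Stable G S
    → (∀ u → 3 ≤ deg G u → S u)
    → (∀ u v w → S u → Edge G u v → Edge G u w → L 𝓛 u v ≡ L 𝓛 u w)
    → (∀ u v → Edge G u v → deg G u ⊔ deg G v ≤ ∣L∣ 𝓛 u v)
    → (∀ u v → Edge G u v → ¬ S u → ¬ S v → 3 ≤ ∣L∣ 𝓛 u v)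
    → ∃ λ (π : Fin n → Fin n → ℕ) → IsListEdgeColouring G 𝓛 π
-- S need not be decidable, but the
-- conditions on it are decidable on subsets of Fin n, so the double-negation of the existence of a
-- decidable S′ satisfying them suffices.
lemma7 G 𝓛 S _ stable high⇒S uniform size free =
  colourable (_∈ˢ? proj₁ found) G (L 𝓛) (admissible G 𝓛 (proj₂ found) size)
  where
  found : ∃ λ X → Conditions G 𝓛 (_∈ˢ X)
  found = decidable-stable (anySubset? λ X → conditions? G 𝓛 (_∈ˢ? X))
            (¬¬-map (λ (X , S⇔X) → X , conditions-resp G 𝓛 S⇔X (stable , high⇒S , uniform , free)) (¬¬-subset S))
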